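{- For each $k \in \mathbb{N}$ and every $n\in\mathbb{Z}$, $$f(n-k, x, q^k s) = \frac{1}{v(k)} \Big(f(k-1, x, qs) f(n, x, s) - f(k, x, s) f(n-1, x, qs)\Big),\qquad v(k) = (-1)^k q^{\binom{k}{2}} s^{k-1}.$$
   Context: Let $q,x,s$ be indeterminates. The Carlitz $q$-Fibonacci polynomials $f(n,x,s)$, $n\in\mathbb{Z}$, are the elements of $\mathbb{Q}(q,x,s)$ determined by $f(0,x,s)=0$, $f(1,x,s)=1$ and $f(n, x, s) = x f(n-1, x, s) + q^{n-2}s f(n-2, x, s)$ for all $n\in\mathbb{Z}$ (used in both directions, so $f$ is defined for negative $n$). $f(m,x,q^a s)$ means $f(m,x,t)$ with $t=q^a s$. -}

module Defs where

open import Level using (Level)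
open import Data.Nat as ℕ using (ℕ; zero; suc)
open import Data.Nat.Combinatorics using (_C_)
open import Data.Integer as ℤ using (ℤ; +_; -[1+_])
open import Data.Product using (_×_; _,_; proj₁; proj₂)
open import Algebra.Bundles using (CommutativeRing)

-- Carlitz q-Fibonacci polynomials, evaluated in an arbitrary commutative
-- ring R in which q and s are units (inverses supplied explicitly).
module CarlitzFib {c ℓ : Level} (R : CommutativeRing c ℓ) where
  open CommutativeRing R

  pow : Carrier → ℕ → Carrier
  pow a zero    = 1#
  pow a (suc m) = a * pow a m

  zpow : (a a⁻¹ : Carrier) → ℤ → Carrier
  zpow a a⁻¹ (+ m)     = pow a m
  zpow a a⁻¹ -[1+ m ]  = pow a⁻¹ (suc m)

  sign : ℕ → Carrier
  sign k = pow (- 1#) k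

  module _ (q q⁻¹ : Carrier) where
    fpos : Carrier → Carrier → ℕ → Carrier
    fpos x t zero          = 0#
    fpos x t (suc zero)    = 1#
    fpos x t (suc (suc m)) = x * fpos x t (suc m) + (pow q m * t) * fpos x t m

    -- fneg x t t⁻¹ m = (f(-m), f(1-m)), using the recurrence backwards:
    -- f(-(m+1)) = (f(1-m) - x f(-m)) * q^(m+1) * t⁻¹
    fneg : Carrier → Carrier → Carrier → ℕ → Carrier × Carrier
    fneg x t t⁻¹ zero    = 0# , 1#
    fneg x t t⁻¹ (suc m) =
      let p = fneg x t t⁻¹ m in
      ((proj₂ p + - (x * proj₁ p)) * (pow q (suc m) * t⁻¹)) , proj₁ p

    f : ℤ → Carrier → (t t⁻¹ : Carrier) → Carrier
    f (+ m)    x t t⁻¹ = fpos x t m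
    f -[1+ m ] x t t⁻¹ = proj₁ (fneg x t t⁻¹ (suc m))

    v : (s s⁻¹ : Carrier) → ℕ → Carrier
    v s s⁻¹ k = sign k * (pow q (k C 2) * zpow s s⁻¹ (+ k ℤ.- + 1))

    vInv : (s s⁻¹ : Carrier) → ℕ → Carrier
    vInv s s⁻¹ k = sign k * (pow q⁻¹ (k C 2) * zpow s⁻¹ s (+ k ℤ.- + 1))

-- Both sides of the identity, as functions of n, solve the two-sided recurrence
-- X(n+2) = x X(n+1) + q^n s X(n).  Its coefficient q^n s is a unit, so a solution
-- is determined by two consecutive values.  The two sides agree at n = k (both are 0)
-- and at n = k+1, where the right side is v(k)⁻¹ times the Casoratian W(k) of the
-- solutions f(n-1, x, qs) and f(n, x, s); from W(0) = s⁻¹ and W(k+1) = -q^k s W(k)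
-- one gets W(k) = v(k).
module Submission where

open import Defs
open import Level using (Level)
open import Data.Nat using (ℕ)
open import Data.Integer as ℤ using (ℤ; +_)
open import Algebra.Bundles using (CommutativeRing)

open import Data.Nat as ℕ using (zero; suc)
open import Data.Nat.Combinatorics using (_C_; nC1≡n; nCk+nC[k+1]≡[n+1]C[k+1])
open import Data.Integer using (-[1+_]; 0ℤ; 1ℤ)
import Data.Integer.Properties as ℤₚ
import Data.Integer.Tactic.RingSolver as ℤ-Solver
open import Data.Product using (_×_; _,_; proj₁; proj₂)
open import Relation.Binary.PropositionalEquality as ≡ using (_≡_)
open import Function using (_∘_)

i+[1+j]≡1+[i+j] : ∀ i j → i ℤ.+ (1ℤ ℤ.+ j) ≡ 1ℤ ℤ.+ (i ℤ.+ j)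
i+[1+j]≡1+[i+j] = ℤ-Solver.solve-∀

[1+i]-j≡1+[i-j] : ∀ i j → (1ℤ ℤ.+ i) ℤ.- j ≡ 1ℤ ℤ.+ (i ℤ.- j)
[1+i]-j≡1+[i-j] = ℤ-Solver.solve-∀

[1+i]-i≡1 : ∀ i → (1ℤ ℤ.+ i) ℤ.- i ≡ 1ℤ
[1+i]-i≡1 = ℤ-Solver.solve-∀

1+[i-1]≡i : ∀ i → 1ℤ ℤ.+ (i ℤ.- 1ℤ) ≡ i
1+[i-1]≡i = ℤ-Solver.solve-∀

i-j+j≡i : ∀ i j → i ℤ.- j ℤ.+ j ≡ i
i-j+j≡i = ℤ-Solver.solve-∀

i+[j-i]≡j : ∀ i j → i ℤ.+ (j ℤ.- i) ≡ j
i+[j-i]≡j = ℤ-Solver.solve-∀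

ℤ-bi-induction : ∀ {p} (P : ℤ → Set p) → P 0ℤ →
  (∀ i → P i → P (ℤ.suc i)) → (∀ i → P (ℤ.suc i) → P i) → ∀ i → P i
ℤ-bi-induction P P0 up down (+ zero)     = P0
ℤ-bi-induction P P0 up down (+ suc m)    = up (+ m) (ℤ-bi-induction P P0 up down (+ m))
ℤ-bi-induction P P0 up down -[1+ zero ]  = down -[1+ zero ] P0
ℤ-bi-induction P P0 up down -[1+ suc m ] = down -[1+ suc m ] (ℤ-bi-induction P P0 up down -[1+ m ])

module CarlitzFibProperties {r ℓ : Level} (R : CommutativeRing r ℓ) where
  open CommutativeRing R
  open CarlitzFib R
  open import Algebra.Properties.Ring ring using (-‿distribˡ-*; -‿distribʳ-*; x[y-z]≈xy-xz; -1*x≈-x)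
  open import Algebra.Properties.AbelianGroup +-abelianGroup
    using (⁻¹-anti-homo‿-; xyx⁻¹≈y; ⁻¹-∙-comm; ⁻¹-involutive; ε⁻¹≈ε)
  open import Algebra.Properties.CommutativeSemigroup +-commutativeSemigroup
    using () renaming (interchange to +-interchange)
  open import Algebra.Properties.CommutativeSemigroup *-commutativeSemigroup
    using () renaming (interchange to *-interchange; x∙yz≈y∙xz to x*yz≈y*xz)
  open import Algebra.Solver.Ring.NaturalCoefficients.Default commutativeSemiring
    using (solve; _:+_; _:*_; _:=_)
  open import Relation.Binary.Reasoning.Setoid setoid

  -x*-y≈x*y : ∀ a b → - a * - b ≈ a * b
  -x*-y≈x*y a b = begin
    - a * - b    ≈⟨ -‿distribˡ-* a (- b) ⟨
    - (a * - b)  ≈⟨ -‿cong (-‿distribʳ-* a b) ⟨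
    - - (a * b)  ≈⟨ ⁻¹-involutive (a * b) ⟩
    a * b        ∎

  [x+y]-[u+v]≈[x-u]+[y-v] : ∀ x y u v → (x + y) - (u + v) ≈ (x - u) + (y - v)
  [x+y]-[u+v]≈[x-u]+[y-v] x y u v = begin
    (x + y) - (u + v)      ≈⟨ +-congˡ (⁻¹-∙-comm u v) ⟨
    (x + y) + (- u + - v)  ≈⟨ +-interchange x y (- u) (- v) ⟩
    (x - u) + (y - v)      ∎

  [x+y]-[x+z]≈y-z : ∀ x y z → (x + y) - (x + z) ≈ y - z
  [x+y]-[x+z]≈y-z x y z = begin
    (x + y) - (x + z)  ≈⟨ [x+y]-[u+v]≈[x-u]+[y-v] x y x z ⟩
    (x - x) + (y - z)  ≈⟨ +-congʳ (-‿inverseʳ x) ⟩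
    0# + (y - z)       ≈⟨ +-identityˡ (y - z) ⟩
    y - z              ∎

  inverse-cancelˡ : ∀ {a b} → a * b ≈ 1# → ∀ y → b * (a * y) ≈ y
  inverse-cancelˡ {a} {b} ab≈1 y = begin
    b * (a * y)  ≈⟨ *-assoc b a y ⟨
    (b * a) * y  ≈⟨ *-congʳ (trans (*-comm b a) ab≈1) ⟩
    1# * y       ≈⟨ *-identityˡ y ⟩
    y            ∎

  inverse-* : ∀ {a a⁻¹ b b⁻¹} → a * a⁻¹ ≈ 1# → b * b⁻¹ ≈ 1# → (a * b) * (a⁻¹ * b⁻¹) ≈ 1#
  inverse-* {a} {a⁻¹} {b} {b⁻¹} aa⁻¹≈1 bb⁻¹≈1 = begin
    (a * b) * (a⁻¹ * b⁻¹)  ≈⟨ *-interchange a b a⁻¹ b⁻¹ ⟩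
    (a * a⁻¹) * (b * b⁻¹)  ≈⟨ *-cong aa⁻¹≈1 bb⁻¹≈1 ⟩
    1# * 1#                ≈⟨ *-identityˡ 1# ⟩
    1#                     ∎

  inverse-cancel-outer : ∀ {a b} → a * b ≈ 1# → ∀ y → a * (y * b) ≈ y
  inverse-cancel-outer {a} {b} ab≈1 y = begin
    a * (y * b)  ≈⟨ x*yz≈y*xz a y b ⟩
    y * (a * b)  ≈⟨ *-congˡ ab≈1 ⟩
    y * 1#       ≈⟨ *-identityʳ y ⟩
    y            ∎

  pow-+ : ∀ a m n → pow a (m ℕ.+ n) ≈ pow a m * pow a n
  pow-+ a zero    n = sym (*-identityˡ (pow a n))
  pow-+ a (suc m) n = trans (*-congˡ (pow-+ a m n)) (sym (*-assoc a (pow a m) (pow a n)))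

  pow-inverse : ∀ {a a⁻¹} → a * a⁻¹ ≈ 1# → ∀ m → pow a m * pow a⁻¹ m ≈ 1#
  pow-inverse aa⁻¹≈1 zero    = *-identityˡ 1#
  pow-inverse aa⁻¹≈1 (suc m) = inverse-* aa⁻¹≈1 (pow-inverse aa⁻¹≈1 m)

  module _ {a a⁻¹ : Carrier} (aa⁻¹≈1 : a * a⁻¹ ≈ 1#) where

    private
      a⁻¹a≈1 : a⁻¹ * a ≈ 1#
      a⁻¹a≈1 = trans (*-comm a⁻¹ a) aa⁻¹≈1

    zpow-suc : ∀ i → zpow a a⁻¹ (ℤ.suc i) ≈ a * zpow a a⁻¹ i
    zpow-suc (+ m)        = refl
    zpow-suc -[1+ zero ]  = sym (trans (*-congˡ (*-identityʳ a⁻¹)) aa⁻¹≈1)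
    zpow-suc -[1+ suc m ] = sym (inverse-cancelˡ a⁻¹a≈1 (pow a⁻¹ (suc m)))

    zpow-inverse : ∀ i → zpow a a⁻¹ i * zpow a⁻¹ a i ≈ 1#
    zpow-inverse (+ m)    = pow-inverse aa⁻¹≈1 m
    zpow-inverse -[1+ m ] = pow-inverse a⁻¹a≈1 (suc m)

    zpow-+ : ∀ i k → zpow a a⁻¹ (i ℤ.+ + k) ≈ zpow a a⁻¹ i * pow a k
    zpow-+ i zero = begin
      zpow a a⁻¹ (i ℤ.+ + 0)  ≡⟨ ≡.cong (zpow a a⁻¹) (ℤₚ.+-identityʳ i) ⟩
      zpow a a⁻¹ i            ≈⟨ *-identityʳ (zpow a a⁻¹ i) ⟨
      zpow a a⁻¹ i * 1#       ∎
    zpow-+ i (suc k) = begin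
      zpow a a⁻¹ (i ℤ.+ + suc k)           ≡⟨ ≡.cong (zpow a a⁻¹) (i+[1+j]≡1+[i+j] i (+ k)) ⟩
      zpow a a⁻¹ (ℤ.suc (i ℤ.+ + k))       ≈⟨ zpow-suc (i ℤ.+ + k) ⟩
      a * zpow a a⁻¹ (i ℤ.+ + k)           ≈⟨ *-congˡ (zpow-+ i k) ⟩
      a * (zpow a a⁻¹ i * pow a k)         ≈⟨ x*yz≈y*xz a (zpow a a⁻¹ i) (pow a k) ⟩
      zpow a a⁻¹ i * (a * pow a k)         ∎

    zpow-minus-pow : ∀ i k → zpow a a⁻¹ (i ℤ.- + k) * pow a k ≈ zpow a a⁻¹ i
    zpow-minus-pow i k = begin
      zpow a a⁻¹ (i ℤ.- + k) * pow a k   ≈⟨ zpow-+ (i ℤ.- + k) k ⟨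
      zpow a a⁻¹ (i ℤ.- + k ℤ.+ + k)     ≡⟨ ≡.cong (zpow a a⁻¹) (i-j+j≡i i (+ k)) ⟩
      zpow a a⁻¹ i                       ∎

  Solution : (a c X : ℤ → Carrier) → Set ℓ
  Solution a c X = ∀ n → X (ℤ.suc (ℤ.suc n)) ≈ a n * X (ℤ.suc n) + c n * X n

  module _ {a c : ℤ → Carrier} where

    solution-backward : ∀ {c⁻¹ X : ℤ → Carrier} → (∀ n → c n * c⁻¹ n ≈ 1#) → Solution a c X →
      ∀ n → X n ≈ c⁻¹ n * (X (ℤ.suc (ℤ.suc n)) - a n * X (ℤ.suc n))
    solution-backward {c⁻¹} {X} c-inverse X-sol n = sym (begin
      c⁻¹ n * (X (ℤ.suc (ℤ.suc n)) - a n * X (ℤ.suc n))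
        ≈⟨ *-congˡ (+-congʳ (X-sol n)) ⟩
      c⁻¹ n * (a n * X (ℤ.suc n) + c n * X n - a n * X (ℤ.suc n))
        ≈⟨ *-congˡ (xyx⁻¹≈y (a n * X (ℤ.suc n)) (c n * X n)) ⟩
      c⁻¹ n * (c n * X n)
        ≈⟨ inverse-cancelˡ (c-inverse n) (X n) ⟩
      X n ∎)

    solution-unique : ∀ {c⁻¹ X Y : ℤ → Carrier} → (∀ n → c n * c⁻¹ n ≈ 1#) →
      Solution a c X → Solution a c Y → ∀ i₀ →
      X i₀ ≈ Y i₀ → X (ℤ.suc i₀) ≈ Y (ℤ.suc i₀) → ∀ i → X i ≈ Y i
    solution-unique {c⁻¹} {X} {Y} c-inverse X-sol Y-sol i₀ X≈Y₀ X≈Y₁ i =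
      proj₁ (≡.subst Agree (i+[j-i]≡j i₀ i)
        (ℤ-bi-induction (λ j → Agree (i₀ ℤ.+ j)) base
          (λ j → ≡.subst Agree (≡.sym (i+[1+j]≡1+[i+j] i₀ j)) ∘ step-up (i₀ ℤ.+ j))
          (λ j → step-down (i₀ ℤ.+ j) ∘ ≡.subst Agree (i+[1+j]≡1+[i+j] i₀ j))
          (i ℤ.- i₀)))
      where
      Agree : ℤ → Set ℓ
      Agree n = X n ≈ Y n × X (ℤ.suc n) ≈ Y (ℤ.suc n)

      base : Agree (i₀ ℤ.+ 0ℤ)
      base = ≡.subst Agree (≡.sym (ℤₚ.+-identityʳ i₀)) (X≈Y₀ , X≈Y₁)

      step-up : ∀ n → Agree n → Agree (ℤ.suc n)
      step-up n (X≈Y , X≈Y′) = X≈Y′ , (begin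
        X (ℤ.suc (ℤ.suc n))                ≈⟨ X-sol n ⟩
        a n * X (ℤ.suc n) + c n * X n      ≈⟨ +-cong (*-congˡ X≈Y′) (*-congˡ X≈Y) ⟩
        a n * Y (ℤ.suc n) + c n * Y n      ≈⟨ Y-sol n ⟨
        Y (ℤ.suc (ℤ.suc n))                ∎)

      step-down : ∀ n → Agree (ℤ.suc n) → Agree n
      step-down n (X≈Y′ , X≈Y″) = (begin
        X n                                                  ≈⟨ solution-backward c-inverse X-sol n ⟩
        c⁻¹ n * (X (ℤ.suc (ℤ.suc n)) - a n * X (ℤ.suc n))    ≈⟨ *-congˡ (+-cong X≈Y″ (-‿cong (*-congˡ X≈Y′))) ⟩
        c⁻¹ n * (Y (ℤ.suc (ℤ.suc n)) - a n * Y (ℤ.suc n))    ≈⟨ solution-backward c-inverse Y-sol n ⟨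
        Y n                                                  ∎) , X≈Y′

    solution-shift : ∀ {X : ℤ → Carrier} → Solution a c X → ∀ j →
      Solution (λ n → a (n ℤ.- j)) (λ n → c (n ℤ.- j)) (λ n → X (n ℤ.- j))
    solution-shift {X} X-sol j n = begin
      X (ℤ.suc (ℤ.suc n) ℤ.- j)      ≡⟨ ≡.cong X ([1+i]-j≡1+[i-j] (ℤ.suc n) j) ⟩
      X (ℤ.suc (ℤ.suc n ℤ.- j))      ≡⟨ ≡.cong (X ∘ ℤ.suc) ([1+i]-j≡1+[i-j] n j) ⟩
      X (ℤ.suc (ℤ.suc (n ℤ.- j)))    ≈⟨ X-sol (n ℤ.- j) ⟩
      a (n ℤ.- j) * X (ℤ.suc (n ℤ.- j)) + c (n ℤ.- j) * X (n ℤ.- j)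
        ≡⟨ ≡.cong (λ m → a (n ℤ.- j) * X m + c (n ℤ.- j) * X (n ℤ.- j)) ([1+i]-j≡1+[i-j] n j) ⟨
      a (n ℤ.- j) * X (ℤ.suc n ℤ.- j) + c (n ℤ.- j) * X (n ℤ.- j) ∎

    solution-cong : ∀ {c′ X : ℤ → Carrier} → (∀ n → c n ≈ c′ n) → Solution a c X → Solution a c′ X
    solution-cong {c′} {X} c≈c′ X-sol n = trans (X-sol n) (+-congˡ (*-congʳ (c≈c′ n)))

    solution-scale : ∀ {X : ℤ → Carrier} α → Solution a c X → Solution a c (λ n → α * X n)
    solution-scale {X} α X-sol n = begin
      α * X (ℤ.suc (ℤ.suc n))                      ≈⟨ *-congˡ (X-sol n) ⟩
      α * (a n * X (ℤ.suc n) + c n * X n)          ≈⟨ solve 5 (λ α a c X₁ X₀ → α :* (a :* X₁ :+ c :* X₀) := a :* (α :* X₁) :+ c :* (α :* X₀))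
                                                         refl α (a n) (c n) (X (ℤ.suc n)) (X n) ⟩
      a n * (α * X (ℤ.suc n)) + c n * (α * X n)    ∎

    solution-minus : ∀ {X Y : ℤ → Carrier} → Solution a c X → Solution a c Y → Solution a c (λ n → X n - Y n)
    solution-minus {X} {Y} X-sol Y-sol n = begin
      X (ℤ.suc (ℤ.suc n)) - Y (ℤ.suc (ℤ.suc n))
        ≈⟨ +-cong (X-sol n) (-‿cong (Y-sol n)) ⟩
      (a n * X (ℤ.suc n) + c n * X n) - (a n * Y (ℤ.suc n) + c n * Y n)
        ≈⟨ [x+y]-[u+v]≈[x-u]+[y-v] _ _ _ _ ⟩
      (a n * X (ℤ.suc n) - a n * Y (ℤ.suc n)) + (c n * X n - c n * Y n)
        ≈⟨ +-cong (x[y-z]≈xy-xz (a n) _ _) (x[y-z]≈xy-xz (c n) _ _) ⟨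
      a n * (X (ℤ.suc n) - Y (ℤ.suc n)) + c n * (X n - Y n) ∎

  casoratian : (X Y : ℤ → Carrier) → ℤ → Carrier
  casoratian X Y n = X n * Y (ℤ.suc n) - X (ℤ.suc n) * Y n

  casoratian-suc : ∀ {a c X Y : ℤ → Carrier} → Solution a c X → Solution a c Y →
    ∀ n → casoratian X Y (ℤ.suc n) ≈ - (c n * casoratian X Y n)
  casoratian-suc {a} {c} {X} {Y} X-sol Y-sol n = begin
    X₁ * Y (ℤ.suc (ℤ.suc n)) - X (ℤ.suc (ℤ.suc n)) * Y₁
      ≈⟨ +-cong (*-congˡ (Y-sol n)) (-‿cong (*-congʳ (X-sol n))) ⟩
    X₁ * (a n * Y₁ + c n * Y₀) - (a n * X₁ + c n * X₀) * Y₁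
      ≈⟨ +-cong (solve 5 (λ X₁ Y₁ a c Y₀ → X₁ :* (a :* Y₁ :+ c :* Y₀) := a :* (X₁ :* Y₁) :+ c :* (X₁ :* Y₀)) refl X₁ Y₁ (a n) (c n) Y₀)
                (-‿cong (solve 5 (λ X₁ Y₁ a c X₀ → (a :* X₁ :+ c :* X₀) :* Y₁ := a :* (X₁ :* Y₁) :+ c :* (X₀ :* Y₁)) refl X₁ Y₁ (a n) (c n) X₀)) ⟩
    (a n * (X₁ * Y₁) + c n * (X₁ * Y₀)) - (a n * (X₁ * Y₁) + c n * (X₀ * Y₁))
      ≈⟨ [x+y]-[x+z]≈y-z _ _ _ ⟩
    c n * (X₁ * Y₀) - c n * (X₀ * Y₁)
      ≈⟨ x[y-z]≈xy-xz (c n) _ _ ⟨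
    c n * (X₁ * Y₀ - X₀ * Y₁)
      ≈⟨ *-congˡ (⁻¹-anti-homo‿- (X₀ * Y₁) (X₁ * Y₀)) ⟨
    c n * - (X₀ * Y₁ - X₁ * Y₀)
      ≈⟨ -‿distribʳ-* (c n) _ ⟨
    - (c n * casoratian X Y n) ∎
    where
    X₀ = X n
    X₁ = X (ℤ.suc n)
    Y₀ = Y n
    Y₁ = Y (ℤ.suc n)

  module Carlitz (q q⁻¹ : Carrier) (qq⁻¹≈1 : q * q⁻¹ ≈ 1#) (x : Carrier) where

    q⁻¹q≈1 : q⁻¹ * q ≈ 1#
    q⁻¹q≈1 = trans (*-comm q⁻¹ q) qq⁻¹≈1

    fneg-proj₁ : ∀ t t⁻¹ m → proj₁ (fneg q q⁻¹ x t t⁻¹ m) ≡ f q q⁻¹ (ℤ.suc -[1+ m ]) x t t⁻¹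
    fneg-proj₁ t t⁻¹ zero    = ≡.refl
    fneg-proj₁ t t⁻¹ (suc m) = ≡.refl

    fneg-proj₂ : ∀ t t⁻¹ m → proj₂ (fneg q q⁻¹ x t t⁻¹ m) ≡ f q q⁻¹ (ℤ.suc (ℤ.suc -[1+ m ])) x t t⁻¹
    fneg-proj₂ t t⁻¹ zero    = ≡.refl
    fneg-proj₂ t t⁻¹ (suc m) = fneg-proj₁ t t⁻¹ m

    f-solution : ∀ {t t⁻¹} → t * t⁻¹ ≈ 1# →
      Solution (λ _ → x) (λ n → zpow q q⁻¹ n * t) (λ n → f q q⁻¹ n x t t⁻¹)
    f-solution tt⁻¹≈1 (+ m) = refl
    f-solution {t} {t⁻¹} tt⁻¹≈1 -[1+ m ] = begin
      f q q⁻¹ (ℤ.suc (ℤ.suc -[1+ m ])) x t t⁻¹  ≡⟨ fneg-proj₂ t t⁻¹ m ⟨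
      f₁                                       ≈⟨ xyx⁻¹≈y (x * f₀) f₁ ⟨
      x * f₀ + f₁ - x * f₀                     ≈⟨ +-assoc (x * f₀) f₁ (- (x * f₀)) ⟩
      x * f₀ + (f₁ - x * f₀)                   ≈⟨ +-congˡ (inverse-cancel-outer ww⁻¹≈1 (f₁ - x * f₀)) ⟨
      x * f₀ + w * ((f₁ - x * f₀) * w⁻¹)       ≡⟨ ≡.cong (λ y → x * y + w * ((f₁ - x * f₀) * w⁻¹)) (fneg-proj₁ t t⁻¹ m) ⟩
      x * f q q⁻¹ (ℤ.suc -[1+ m ]) x t t⁻¹ + w * f q q⁻¹ -[1+ m ] x t t⁻¹ ∎
      where
      f₀ = proj₁ (fneg q q⁻¹ x t t⁻¹ m)
      f₁ = proj₂ (fneg q q⁻¹ x t t⁻¹ m)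
      w  = pow q⁻¹ (suc m) * t
      w⁻¹ = pow q (suc m) * t⁻¹
      ww⁻¹≈1 : w * w⁻¹ ≈ 1#
      ww⁻¹≈1 = inverse-* (pow-inverse q⁻¹q≈1 (suc m)) tt⁻¹≈1

    f-shifted-solution : ∀ k {t T T⁻¹} → T * T⁻¹ ≈ 1# → T ≈ pow q k * t →
      Solution (λ _ → x) (λ n → zpow q q⁻¹ n * t) (λ n → f q q⁻¹ (n ℤ.- + k) x T T⁻¹)
    f-shifted-solution k {t} {T} TT⁻¹≈1 T≈qᵏt =
      solution-cong coefficient (solution-shift (f-solution TT⁻¹≈1) (+ k))
      where
      coefficient : ∀ n → zpow q q⁻¹ (n ℤ.- + k) * T ≈ zpow q q⁻¹ n * t
      coefficient n = begin
        zpow q q⁻¹ (n ℤ.- + k) * T              ≈⟨ *-congˡ T≈qᵏt ⟩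
        zpow q q⁻¹ (n ℤ.- + k) * (pow q k * t)  ≈⟨ *-assoc _ _ _ ⟨
        zpow q q⁻¹ (n ℤ.- + k) * pow q k * t    ≈⟨ *-congʳ (zpow-minus-pow qq⁻¹≈1 n k) ⟩
        zpow q q⁻¹ n * t                        ∎

    f-minus-one : ∀ t t⁻¹ → f q q⁻¹ -[1+ 0 ] x t t⁻¹ ≈ q * t⁻¹
    f-minus-one t t⁻¹ = begin
      (1# - x * 0#) * ((q * 1#) * t⁻¹)  ≈⟨ *-cong 1-x*0≈1 (*-congʳ (*-identityʳ q)) ⟩
      1# * (q * t⁻¹)                    ≈⟨ *-identityˡ (q * t⁻¹) ⟩
      q * t⁻¹                           ∎
      where
      1-x*0≈1 : 1# - x * 0# ≈ 1#
      1-x*0≈1 = trans (+-congˡ (trans (-‿cong (zeroʳ x)) ε⁻¹≈ε)) (+-identityʳ 1#)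

    module Expansion (s s⁻¹ : Carrier) (ss⁻¹≈1 : s * s⁻¹ ≈ 1#) where

      s⁻¹s≈1 : s⁻¹ * s ≈ 1#
      s⁻¹s≈1 = trans (*-comm s⁻¹ s) ss⁻¹≈1

      coeff coeff⁻¹ : ℤ → Carrier
      coeff   n = zpow q q⁻¹ n * s
      coeff⁻¹ n = zpow q⁻¹ q n * s⁻¹

      coeff-inverse : ∀ n → coeff n * coeff⁻¹ n ≈ 1#
      coeff-inverse n = inverse-* (zpow-inverse qq⁻¹≈1 n) ss⁻¹≈1

      F F′ : ℤ → Carrier
      F  n = f q q⁻¹ n x s s⁻¹
      F′ n = f q q⁻¹ (n ℤ.- + 1) x (q * s) (q⁻¹ * s⁻¹)

      F-solution : Solution (λ _ → x) coeff F
      F-solution = f-solution ss⁻¹≈1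

      F′-solution : Solution (λ _ → x) coeff F′
      F′-solution = f-shifted-solution 1 (inverse-* qq⁻¹≈1 ss⁻¹≈1) (*-congʳ (sym (*-identityʳ q)))

      vInv-zero : vInv q q⁻¹ s s⁻¹ 0 ≈ s
      vInv-zero = trans (*-identityˡ _) (trans (*-identityˡ _) (*-identityʳ s))

      vInv-suc : ∀ k → vInv q q⁻¹ s s⁻¹ (suc k) ≈ - ((pow q⁻¹ k * s⁻¹) * vInv q q⁻¹ s s⁻¹ k)
      vInv-suc k = begin
        (- 1# * σ) * (pow q⁻¹ (suc k C 2) * zpow s⁻¹ s (+ k))
          ≡⟨ ≡.cong (λ m → (- 1# * σ) * (pow q⁻¹ m * zpow s⁻¹ s (+ k))) [1+k]C2≡k+kC2 ⟩
        (- 1# * σ) * (pow q⁻¹ (k ℕ.+ k C 2) * zpow s⁻¹ s (+ k))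
          ≈⟨ *-congˡ (*-cong (pow-+ q⁻¹ k (k C 2)) zpow-s⁻¹-k) ⟩
        (- 1# * σ) * ((pow q⁻¹ k * E) * (s⁻¹ * Z))
          ≈⟨ solve 6 (λ m σ Q E S Z → (m :* σ) :* ((Q :* E) :* (S :* Z)) := m :* ((Q :* S) :* (σ :* (E :* Z))))
                refl (- 1#) σ (pow q⁻¹ k) E s⁻¹ Z ⟩
        - 1# * ((pow q⁻¹ k * s⁻¹) * (σ * (E * Z)))
          ≈⟨ -1*x≈-x _ ⟩
        - ((pow q⁻¹ k * s⁻¹) * vInv q q⁻¹ s s⁻¹ k) ∎
        where
        σ = sign k
        E = pow q⁻¹ (k C 2)
        Z = zpow s⁻¹ s (+ k ℤ.- + 1)
        [1+k]C2≡k+kC2 : suc k C 2 ≡ k ℕ.+ k C 2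
        [1+k]C2≡k+kC2 = ≡.trans (≡.sym (nCk+nC[k+1]≡[n+1]C[k+1] k 1)) (≡.cong (ℕ._+ k C 2) (nC1≡n k))
        zpow-s⁻¹-k : zpow s⁻¹ s (+ k) ≈ s⁻¹ * Z
        zpow-s⁻¹-k = begin
          zpow s⁻¹ s (+ k)                      ≡⟨ ≡.cong (zpow s⁻¹ s) (1+[i-1]≡i (+ k)) ⟨
          zpow s⁻¹ s (ℤ.suc (+ k ℤ.- + 1))      ≈⟨ zpow-suc s⁻¹s≈1 (+ k ℤ.- + 1) ⟩
          s⁻¹ * Z                               ∎

      casoratian-zero : casoratian F′ F 0ℤ ≈ s⁻¹
      casoratian-zero = begin
        F′ 0ℤ * 1# - 0# * 0#  ≈⟨ +-cong (*-identityʳ (F′ 0ℤ)) (trans (-‿cong (zeroˡ 0#)) ε⁻¹≈ε) ⟩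
        F′ 0ℤ + 0#            ≈⟨ +-identityʳ (F′ 0ℤ) ⟩
        F′ 0ℤ                 ≈⟨ f-minus-one (q * s) (q⁻¹ * s⁻¹) ⟩
        q * (q⁻¹ * s⁻¹)       ≈⟨ inverse-cancelˡ q⁻¹q≈1 s⁻¹ ⟩
        s⁻¹                   ∎

      vInv-*-casoratian : ∀ k → vInv q q⁻¹ s s⁻¹ k * casoratian F′ F (+ k) ≈ 1#
      vInv-*-casoratian zero = trans (*-cong vInv-zero casoratian-zero) ss⁻¹≈1
      vInv-*-casoratian (suc k) = begin
        vInv q q⁻¹ s s⁻¹ (suc k) * casoratian F′ F (+ suc k)
          ≈⟨ *-cong (vInv-suc k) (casoratian-suc F′-solution F-solution (+ k)) ⟩
        - (c⁻¹ * V) * - (c * W)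
          ≈⟨ -x*-y≈x*y (c⁻¹ * V) (c * W) ⟩
        (c⁻¹ * V) * (c * W)
          ≈⟨ *-interchange c⁻¹ V c W ⟩
        (c⁻¹ * c) * (V * W)
          ≈⟨ *-cong (inverse-* (pow-inverse q⁻¹q≈1 k) s⁻¹s≈1) (vInv-*-casoratian k) ⟩
        1# * 1#
          ≈⟨ *-identityˡ 1# ⟩
        1# ∎
        where
        c   = pow q k * s
        c⁻¹ = pow q⁻¹ k * s⁻¹
        V   = vInv q q⁻¹ s s⁻¹ k
        W   = casoratian F′ F (+ k)

      f[q^k*s] : ℕ → ℤ → Carrier
      f[q^k*s] k n = f q q⁻¹ n x (pow q k * s) (pow q⁻¹ k * s⁻¹)

      shifted combination : ℕ → ℤ → Carrier
      shifted     k n = f[q^k*s] k (n ℤ.- + k)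
      combination k n = vInv q q⁻¹ s s⁻¹ k * (F′ (+ k) * F n - F (+ k) * F′ n)

      shifted-solution : ∀ k → Solution (λ _ → x) coeff (shifted k)
      shifted-solution k = f-shifted-solution k (inverse-* (pow-inverse qq⁻¹≈1 k) ss⁻¹≈1) refl

      combination-solution : ∀ k → Solution (λ _ → x) coeff (combination k)
      combination-solution k = solution-scale (vInv q q⁻¹ s s⁻¹ k)
        (solution-minus (solution-scale (F′ (+ k)) F-solution) (solution-scale (F (+ k)) F′-solution))

      shifted≈combination-at-k : ∀ k → shifted k (+ k) ≈ combination k (+ k)
      shifted≈combination-at-k k = begin
        shifted k (+ k)                      ≡⟨ ≡.cong (f[q^k*s] k) (ℤₚ.+-inverseʳ (+ k)) ⟩
        0#                                   ≈⟨ zeroʳ V ⟨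
        V * 0#                               ≈⟨ *-congˡ (-‿inverseʳ (A * B)) ⟨
        V * (A * B - A * B)                  ≈⟨ *-congˡ (+-congˡ (-‿cong (*-comm A B))) ⟩
        combination k (+ k)                  ∎
        where
        V = vInv q q⁻¹ s s⁻¹ k
        A = F′ (+ k)
        B = F (+ k)

      shifted≈combination-at-suc-k : ∀ k → shifted k (+ suc k) ≈ combination k (+ suc k)
      shifted≈combination-at-suc-k k = begin
        shifted k (+ suc k)                    ≡⟨ ≡.cong (f[q^k*s] k) ([1+i]-i≡1 (+ k)) ⟩
        1#                                     ≈⟨ vInv-*-casoratian k ⟨
        V * casoratian F′ F (+ k)              ≈⟨ *-congˡ (+-congˡ (-‿cong (*-comm _ _))) ⟩
        combination k (+ suc k)                ∎
        where
        V = vInv q q⁻¹ s s⁻¹ k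

corollary2 : {c ℓ : Level} (R : CommutativeRing c ℓ) →
    let open CommutativeRing R in
    let open CarlitzFib R in
    (q q⁻¹ x s s⁻¹ : Carrier) → q * q⁻¹ ≈ 1# → s * s⁻¹ ≈ 1# →
    (k : ℕ) (n : ℤ) →
    f q q⁻¹ (n ℤ.- + k) x (pow q k * s) (pow q⁻¹ k * s⁻¹)
      ≈ vInv q q⁻¹ s s⁻¹ k
          * (f q q⁻¹ (+ k ℤ.- + 1) x (q * s) (q⁻¹ * s⁻¹) * f q q⁻¹ n x s s⁻¹
             + - (f q q⁻¹ (+ k) x s s⁻¹ * f q q⁻¹ (n ℤ.- + 1) x (q * s) (q⁻¹ * s⁻¹)))
corollary2 R q q⁻¹ x s s⁻¹ qq⁻¹≈1 ss⁻¹≈1 k =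
  solution-unique coeff-inverse (shifted-solution k) (combination-solution k)
    (+ k) (shifted≈combination-at-k k) (shifted≈combination-at-suc-k k)
  where
  open CarlitzFibProperties R
  open Carlitz q q⁻¹ qq⁻¹≈1 x
  open Expansion s s⁻¹ ss⁻¹≈1
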